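{- For all integers $m>2$, the Pisano periods $\pi_F(m)$ and $\pi_L(m)$ of the Fibonacci and Lucas sequences modulo $m$ are even. More generally, if $G_0,G_1\in\mathbb{Z}$ satisfy $G_1^2-G_0G_1-G_0^2=\pm1$, then $\pi_{G_0,G_1}(m)$ is even for all $m>2$.
   Context: For a sequence $(G_n)_{n\ge0}$ with $G_n=G_{n-1}+G_{n-2}$ ($n\ge2$) and $m\ge2$, $\pi_{G_0,G_1}(m)$ is the smallest positive integer $r$ with $G_r\equiv G_0$ and $G_{r+1}\equiv G_1\pmod m$. $\pi_F(m)$ and $\pi_L(m)$ are this period for the Fibonacci sequence ($G_0=0,G_1=1$) and the Lucas sequence ($G_0=2,G_1=1$). -}

module Defs where

open import Data.Nat using (ℕ; zero; suc; _<_)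
open import Data.Integer using (ℤ; +_; _-_)
open import Data.Integer.Divisibility using (_∣_)

G : ℤ → ℤ → ℕ → ℤ
G g0 g1 zero = g0
G g0 g1 (suc zero) = g1
G g0 g1 (suc (suc n)) = G g0 g1 (suc n) Data.Integer.+ G g0 g1 n

_≡_[mod_] : ℤ → ℤ → ℕ → Set
a ≡ b [mod m ] = (+ m) ∣ (a - b)

Returns : ℤ → ℤ → ℕ → ℕ → Set
Returns g0 g1 m r = (G g0 g1 r ≡ g0 [mod m ]) Data.Product.× (G g0 g1 (suc r) ≡ g1 [mod m ])
  where import Data.Product

IsPeriod : ℤ → ℤ → ℕ → ℕ → Set
IsPeriod g0 g1 m r =
  (0 < r) Data.Product.× Returns g0 g1 m r Data.Product.×
  (∀ s → 0 < s → s < r → ¬ Returns g0 g1 m s)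
  where import Data.Product
        open import Relation.Nullary using (¬_)

-- Q(a, b) = b² − ab − a² satisfies Q(b, a + b) = −Q(a, b), so along the sequence
-- Q(G_n, G_{n+1}) = (−1)ⁿ Q(G_0, G_1). If the pair (G_0, G_1) recurs modulo m after an odd
-- number r of steps, then Q(G_0, G_1) ≡ Q(G_r, G_{r+1}) = −Q(G_0, G_1), i.e. m ∣ 2Q(G_0, G_1).
-- For Q = ±1 this forces m ≤ 2. For the Lucas numbers Q = −5, so m ∣ 10 leaves only m ∈ {5, 10},
-- whose periods 4 and 12 are checked directly.
module Submission where

open import Defs
open import Data.Nat using (ℕ; _<_)
open import Data.Integer using (ℤ; _*_; _-_; +_; -_)
open import Data.Nat.Divisibility using (_∣_)
open import Data.Product using (_×_)
open import Data.Sum using (_⊎_)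
open import Relation.Binary.PropositionalEquality using (_≡_)

open import Data.Nat as ℕ using (zero; suc; _≤_; _<?_; s≤s; z≤n)
open import Data.Nat.Properties using (≮⇒≥; <⇒≱)
open import Data.Nat.Divisibility using (divides; _∣?_; ∣⇒≤)
open import Data.Integer using (_+_; ∣_∣)
open import Data.Integer.Properties using (neg-involutive; ∣-i∣≡∣i∣; abs-*)
import Data.Integer.Divisibility.Signed as Signed
open import Data.Integer.Solver using (module +-*-Solver)
open import Data.Fin using (Fin; toℕ; fromℕ<)
open import Data.Fin.Properties using (all?; toℕ-fromℕ<)
open import Data.Product using (_,_; ∃)
open import Data.Sum using (inj₁; inj₂)
open import Data.Empty using (⊥-elim)
open import Relation.Nullary using (Dec)
open import Relation.Nullary.Decidable using (toWitness; _×-dec_; _→-dec_; _⊎-dec_)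
open import Relation.Binary.PropositionalEquality using (refl; sym; trans; cong; subst)
open +-*-Solver

form : ℤ → ℤ → ℤ
form a b = b * b - a * b - a * a

form-step : ∀ a b → form b (b + a) ≡ - form a b
form-step = solve 2 (λ a b → (b :+ a) :* (b :+ a) :- b :* (b :+ a) :- b :* b
                             := :- (b :* b :- a :* b :- a :* a)) refl

form-cong : ∀ {m} a a′ b b′ → a ≡ a′ [mod m ] → b ≡ b′ [mod m ] → form a b ≡ form a′ b′ [mod m ]
form-cong {m} a a′ b b′ a≡a′ b≡b′ =
  Signed.∣⇒∣ᵤ (subst (Signed._∣_ (+ m)) (sym (difference a a′ b b′))
    (Signed.∣m∣n⇒∣m-n (Signed.∣m⇒∣m*n (b + b′ - a′) (Signed.∣ᵤ⇒∣ {+ m} {b - b′} b≡b′))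
                      (Signed.∣m⇒∣m*n (b + a + a′) (Signed.∣ᵤ⇒∣ {+ m} {a - a′} a≡a′))))
  where
  difference : ∀ a a′ b b′ → form a b - form a′ b′ ≡ (b - b′) * (b + b′ - a′) - (a - a′) * (b + a + a′)
  difference = solve 4 (λ a a′ b b′ → (b :* b :- a :* b :- a :* a) :- (b′ :* b′ :- a′ :* b′ :- a′ :* a′)
                         := (b :- b′) :* (b :+ b′ :- a′) :- (a :- a′) :* (b :+ a :+ a′)) refl

∣-x-x∣≡2∣x∣ : ∀ x → ∣ - x - x ∣ ≡ 2 ℕ.* ∣ x ∣
∣-x-x∣≡2∣x∣ x = trans (cong ∣_∣ (-x-x≡-[2x] x)) (trans (∣-i∣≡∣i∣ (+ 2 * x)) (abs-* (+ 2) x))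
  where
  -x-x≡-[2x] : ∀ x → - x - x ≡ - (+ 2 * x)
  -x-x≡-[2x] = solve 1 (λ x → :- x :- x := :- (con (+ 2) :* x)) refl

even-or-odd : ∀ n → ∃ (λ k → n ≡ k ℕ.* 2) ⊎ ∃ (λ k → n ≡ suc (k ℕ.* 2))
even-or-odd zero = inj₁ (0 , refl)
even-or-odd (suc n) with even-or-odd n
... | inj₁ (k , n≡2k) = inj₂ (k , cong suc n≡2k)
... | inj₂ (k , n≡2k+1) = inj₁ (suc k , cong suc n≡2k+1)

returns? : ∀ g0 g1 m r → Dec (Returns g0 g1 m r)
returns? g0 g1 m r = (m ∣? ∣ G g0 g1 r - g0 ∣) ×-dec (m ∣? ∣ G g0 g1 (suc r) - g1 ∣)

module _ (g0 g1 : ℤ) where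

  formAt : ℕ → ℤ
  formAt n = form (G g0 g1 n) (G g0 g1 (suc n))

  formAt-step : ∀ n → formAt (suc n) ≡ - formAt n
  formAt-step n = form-step (G g0 g1 n) (G g0 g1 (suc n))

  formAt-even : ∀ k → formAt (k ℕ.* 2) ≡ form g0 g1
  formAt-odd : ∀ k → formAt (suc (k ℕ.* 2)) ≡ - form g0 g1
  formAt-even zero = refl
  formAt-even (suc k) =
    trans (formAt-step (suc (k ℕ.* 2))) (trans (cong -_ (formAt-odd k)) (neg-involutive _))
  formAt-odd k = trans (formAt-step (k ℕ.* 2)) (cong -_ (formAt-even k))

  returns-even-or-∣2form : ∀ {m r} → Returns g0 g1 m r → (2 ∣ r) ⊎ (m ∣ 2 ℕ.* ∣ form g0 g1 ∣)
  returns-even-or-∣2form {m} {r} (Gr≡g0 , Gr+1≡g1) with even-or-odd r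
  ... | inj₁ (k , r≡2k) = inj₁ (divides k r≡2k)
  ... | inj₂ (k , refl) = inj₂ (subst (m ∣_) (∣-x-x∣≡2∣x∣ (form g0 g1)) -Q≡Q)
    where
    -Q≡Q : (- form g0 g1) ≡ form g0 g1 [mod m ]
    -Q≡Q = subst (λ x → x ≡ form g0 g1 [mod m ]) (formAt-odd k)
                 (form-cong (G g0 g1 r) g0 (G g0 g1 (suc r)) g1 Gr≡g0 Gr+1≡g1)

  period≤return : ∀ {m r s} → IsPeriod g0 g1 m r → 0 < s → Returns g0 g1 m s → r ≤ s
  period≤return (_ , _ , minimal) 0<s returns-s = ≮⇒≥ (λ s<r → minimal _ 0<s s<r returns-s)

  period-even-if-returns-even-upTo : ∀ {m r} s → 0 < s → Returns g0 g1 m s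
    → (∀ (i : Fin (suc s)) → Returns g0 g1 m (toℕ i) → 2 ∣ toℕ i)
    → IsPeriod g0 g1 m r → 2 ∣ r
  period-even-if-returns-even-upTo {r = r} s 0<s returns-s even-upTo period@(_ , returns-r , _) =
    subst (2 ∣_) r≡i (even-upTo i (subst (Returns g0 g1 _) (sym r≡i) returns-r))
    where
    r<1+s : r < suc s
    r<1+s = s≤s (period≤return period 0<s returns-s)
    i : Fin (suc s)
    i = fromℕ< r<1+s
    r≡i : toℕ i ≡ r
    r≡i = toℕ-fromℕ< r<1+s

period-even-of-unit-form : (g0 g1 : ℤ) → (form g0 g1 ≡ + 1) ⊎ (form g0 g1 ≡ - (+ 1))
  → (m r : ℕ) → 2 < m → IsPeriod g0 g1 m r → 2 ∣ r
period-even-of-unit-form g0 g1 unit m r 2<m (_ , returns-r , _) with returns-even-or-∣2form g0 g1 returns-r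
... | inj₁ 2∣r = 2∣r
... | inj₂ m∣2Q = ⊥-elim (<⇒≱ 2<m (∣⇒≤ (subst (λ q → m ∣ 2 ℕ.* q) (∣Q∣≡1 unit) m∣2Q)))
  where
  ∣Q∣≡1 : (form g0 g1 ≡ + 1) ⊎ (form g0 g1 ≡ - (+ 1)) → ∣ form g0 g1 ∣ ≡ 1
  ∣Q∣≡1 (inj₁ Q≡1) = cong ∣_∣ Q≡1
  ∣Q∣≡1 (inj₂ Q≡-1) = cong ∣_∣ Q≡-1

divisor-of-10 : ∀ {m} → 2 < m → m ∣ 10 → m ≡ 5 ⊎ m ≡ 10
divisor-of-10 {m} 2<m m∣10 =
  subst P (toℕ-fromℕ< m<11) (all-P (fromℕ< m<11)) 2<m m∣10
  where
  P : ℕ → Set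
  P n = 2 < n → n ∣ 10 → n ≡ 5 ⊎ n ≡ 10
  m<11 : m < 11
  m<11 = s≤s (∣⇒≤ m∣10)
  all-P : ∀ (i : Fin 11) → P (toℕ i)
  all-P = toWitness {a? = all? (λ i → 2 <? toℕ i →-dec toℕ i ∣? 10 →-dec (toℕ i ℕ.≟ 5 ⊎-dec toℕ i ℕ.≟ 10))} _

lucas-period-even : (m r : ℕ) → 2 < m → IsPeriod (+ 2) (+ 1) m r → 2 ∣ r
lucas-period-even m r 2<m period@(_ , returns-r , _) with returns-even-or-∣2form (+ 2) (+ 1) returns-r
... | inj₁ 2∣r = 2∣r
... | inj₂ m∣10 with divisor-of-10 2<m m∣10
... | inj₁ refl = period-even-if-returns-even-upTo (+ 2) (+ 1) 4 (s≤s z≤n)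
                    (toWitness {a? = returns? (+ 2) (+ 1) 5 4} _)
                    (toWitness {a? = all? (λ i → returns? (+ 2) (+ 1) 5 (toℕ i) →-dec 2 ∣? toℕ i)} _) period
... | inj₂ refl = period-even-if-returns-even-upTo (+ 2) (+ 1) 12 (s≤s z≤n)
                    (toWitness {a? = returns? (+ 2) (+ 1) 10 12} _)
                    (toWitness {a? = all? (λ i → returns? (+ 2) (+ 1) 10 (toℕ i) →-dec 2 ∣? toℕ i)} _) period

corollary5p3 : ((m r : ℕ) → 2 < m → IsPeriod (+ 0) (+ 1) m r → 2 ∣ r)
    × ((m r : ℕ) → 2 < m → IsPeriod (+ 2) (+ 1) m r → 2 ∣ r)
    × ((g0 g1 : ℤ) → ((g1 * g1 - g0 * g1 - g0 * g0 ≡ + 1) ⊎ (g1 * g1 - g0 * g1 - g0 * g0 ≡ - (+ 1)))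
    → (m r : ℕ) → 2 < m → IsPeriod g0 g1 m r → 2 ∣ r)
corollary5p3 = period-even-of-unit-form (+ 0) (+ 1) (inj₁ refl) , lucas-period-even , period-even-of-unit-form
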